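{- For every $n\ge1$ and every $\sigma\in\mathfrak S_n$ one has $$E\sigma=(D+D')\hat\sigma\quad\text{and}\quad \Delta E\sigma=\Delta D\hat\sigma,$$ where $(D+D')\tau$ denotes the coordinatewise sum $D\tau+D'\tau$.
   Context: $[n]=\{1,\dots,n\}$, $\mathfrak S_n$ the symmetric group on $[n]$, $x_+=\max\{0,x\}$. For $\sigma\in\mathfrak S_n$: $E\sigma\in\mathbb N^n$ with $E\sigma(k)=(\sigma(k)-(k-1))_+$; with the convention $\sigma(0)=0$, $D\sigma\in\mathbb N^n$ with $D\sigma(k)=(\sigma(\sigma^{ -1}(k)-1)-(k-1))_+$. For $p\ge1$, $\Delta:\mathbb N^p\to\mathbb N^{p-1}$, $\Delta(x_1,\dots,x_p)=((x_1-1)_+,\dots,(x_{p-1}-1)_+)$. An entry $\tau(i)$ of the sequence $(\tau(1),\dots,\tau(n))$ is called saillant (a left-to-right maximum) if $\tau(i')<\tau(i)$ for all $i'<i$. For $\tau\in\mathfrak S_n$, $D'\tau\in\{0,1\}^n$ is defined by: $D'\tau(j)=1$ if the value $j$ is saillant in $(\tau(1),\dots,\tau(n))$ and either $\tau^{ -1}(j)=n$, or $\tau^{ -1}(j)\le n-1$ and $\tau(\tau^{ -1}(j)+1)$ is also saillant; $D'\tau(j)=0$ otherwise. The permutation $\hat\sigma$: for $k\in[n]$ let $\bar k$ be the maximum of the $\sigma$-orbit of $k$, $q_k=\min\{p\ge0:\sigma^p(k)=\bar k\}$, $\Pi_\sigma(k)=(\bar k,q_k)$; then $\hat\sigma\in\mathfrak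 S_n$ is the unique permutation such that $\Pi_\sigma(\hat\sigma(1)),\dots,\Pi_\sigma(\hat\sigma(n))$ is lexicographically increasing. -}

module Defs where

open import Data.Nat using (ℕ; zero; suc; _+_; _∸_; _⊔_; _<_; _≡ᵇ_; _<ᵇ_)
open import Data.Bool using (Bool; true; false; if_then_else_)
open import Data.Fin using (Fin; zero; suc; toℕ; inject₁)
import Data.Fin as F
open import Data.Fin.Permutation using (Permutation′; _⟨$⟩ʳ_; _⟨$⟩ˡ_)
open import Data.Maybe using (Maybe; just; nothing)
import Data.Maybe as Maybe
open import Data.Product using (_×_)
open import Data.Sum using (_⊎_)
open import Relation.Binary.PropositionalEquality using (_≡_)
open import Relation.Nullary using (Dec; yes; no; does; _×-dec_; _→-dec_)
import Data.Fin.Properties as FP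
import Data.Nat.Properties as NP

-- Conventions: [n] is represented by Fin n, with the element i : Fin n
-- standing for the integer toℕ i + 1.  Vectors in ℕ^n are functions Fin n → ℕ.

val : ∀ {n} → Permutation′ n → Fin n → ℕ
val σ k = suc (toℕ (σ ⟨$⟩ʳ k))

-- E σ (k) = (σ(k) - (k-1))₊ ; here k-1 = toℕ k
E : ∀ {n} → Permutation′ n → Fin n → ℕ
E σ k = val σ k ∸ toℕ k

-- σ(p-1) for a position p, with the convention σ(0) = 0
prevVal : ∀ {n} → Permutation′ n → Fin n → ℕ
prevVal {suc m} σ zero    = 0
prevVal {suc m} σ (suc q) = val σ (inject₁ q)

-- D σ (k) = (σ(σ⁻¹(k) - 1) - (k-1))₊
D : ∀ {n} → Permutation′ n → Fin n → ℕ
D σ k = prevVal σ (σ ⟨$⟩ˡ k) ∸ toℕ k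

Δ : ∀ {m} → (Fin (suc m) → ℕ) → (Fin m → ℕ)
Δ x i = x (inject₁ i) ∸ 1

Saillant : ∀ {n} → Permutation′ n → Fin n → Set
Saillant τ i = ∀ i′ → i′ F.< i → (τ ⟨$⟩ʳ i′) F.< (τ ⟨$⟩ʳ i)

saillant? : ∀ {n} (τ : Permutation′ n) (i : Fin n) → Dec (Saillant τ i)
saillant? τ i = FP.all? (λ i′ → (i′ FP.<? i) →-dec ((τ ⟨$⟩ʳ i′) FP.<? (τ ⟨$⟩ʳ i)))

nextPos : ∀ {n} → Fin n → Maybe (Fin n)
nextPos {suc zero}     zero    = nothing
nextPos {suc (suc m)}  zero    = just (suc zero)
nextPos {suc (suc m)}  (suc q) = Maybe.map suc (nextPos q)

D′ : ∀ {n} → Permutation′ n → Fin n → ℕ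
D′ τ j = if does (saillant? τ p) then nextOK (nextPos p) else 0
  where
  p = τ ⟨$⟩ˡ j
  nextOK : Maybe (Fin _) → ℕ
  nextOK nothing  = 1
  nextOK (just q) = if does (saillant? τ q) then 1 else 0

iter : ∀ {n} → Permutation′ n → ℕ → Fin n → Fin n
iter σ zero    k = k
iter σ (suc p) k = σ ⟨$⟩ʳ iter σ p k

maxUpTo : ∀ {n} → Permutation′ n → Fin n → ℕ → ℕ
maxUpTo σ k zero    = toℕ k
maxUpTo σ k (suc r) = maxUpTo σ k r ⊔ toℕ (iter σ (suc r) k)

-- k̄ (0-based, as a natural number): the maximum of the σ-orbit of k.
-- The orbit of k is { σ^p k : p < n }, since orbits have size ≤ n.
orbitMax : ∀ {n} → Permutation′ n → Fin n → ℕ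
orbitMax {n} σ k = maxUpTo σ k (n ∸ 1)

-- least p < bound satisfying f (returns bound if none)
leastBelow : (ℕ → Bool) → ℕ → ℕ
leastBelow f zero    = zero
leastBelow f (suc b) with leastBelow f b
... | r = if r <ᵇ b then r else (if f b then b else suc b)

-- q_k = min { p ≥ 0 : σ^p(k) = k̄ }  (attained at some p < n)
qIndex : ∀ {n} → Permutation′ n → Fin n → ℕ
qIndex {n} σ k = leastBelow (λ p → toℕ (iter σ p k) ≡ᵇ orbitMax σ k) n

_,_<lex_,_ : ℕ → ℕ → ℕ → ℕ → Set
a , b <lex c , d = (a < c) ⊎ ((a ≡ c) × (b < d))

-- (Π_σ(τ(1)), …, Π_σ(τ(n))) is lexicographically increasing,
-- with Π_σ(k) = (k̄, q_k); i.e. τ = σ̂.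
IsHat : ∀ {n} → Permutation′ n → Permutation′ n → Set
IsHat σ τ = ∀ i j → i F.< j →
  orbitMax σ (τ ⟨$⟩ʳ i) , qIndex σ (τ ⟨$⟩ʳ i) <lex orbitMax σ (τ ⟨$⟩ʳ j) , qIndex σ (τ ⟨$⟩ʳ j)

{-# OPTIONS --safe #-}
module Submission where

-- Sort [n] by the key Π_σ(k) = (k̄, q_k).  In the cycle with maximum c the keys
-- (c, 0), (c, 1), (c, 2), … belong to c, σ⁻¹ c, σ⁻² c, …, so σ̂ lists the cycles by
-- increasing maximum, each one starting at its maximum and then running backwards
-- along σ.  Hence an entry k that is not a cycle maximum is immediately preceded by
-- σ(k), which gives Dσ̂(k) = Eσ(k), and it is not saillant, so D′σ̂(k) = 0.  The cycle
-- maxima are exactly the saillant entries; for these Dσ̂(k) = 0, while Eσ(k) ∈ {0, 1}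
-- is 1 iff k is a fixed point, i.e. iff the entry after k is again a cycle maximum
-- (or there is none), which is D′σ̂(k).  In both cases Eσ(k) ∸ 1 = Dσ̂(k) ∸ 1.
-- Finally σ̂ exists because the keys are distinct: rank each k by the number of smaller keys.

open import Defs
open import Data.Bool using (Bool; true; false; T; if_then_else_)
open import Data.Bool.Properties using (T-≡; if-cong; if-cong-then; if-eta)
open import Data.Fin using (Fin; zero; suc; toℕ; inject₁; fromℕ<; punchOut)
import Data.Fin as F
import Data.Fin.Properties as FP
open import Data.Fin.Permutation using (Permutation′; _⟨$⟩ʳ_; _⟨$⟩ˡ_; inverseˡ; inverseʳ; permutation; flip)
open import Data.Fin.Subset using (Subset; _∈_; ∣_∣)
open import Data.Fin.Subset.Properties using (p⊂q⇒∣p∣<∣q∣; ∈⊤; ∣⊤∣≡n)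
open import Data.Maybe using (Maybe; just; nothing)
import Data.Maybe as Maybe
open import Data.Nat
  using (ℕ; zero; suc; _+_; _*_; _∸_; _<_; _≤_; _≡ᵇ_; _<ᵇ_; z≤n; s≤s; s≤s⁻¹; z<s; s<s)
open import Data.Nat.DivMod using (_%_; _/_; m≡m%n+[m/n]*n; m%n<n)
import Data.Nat.Properties as NP
open import Data.Product using (Σ; ∃; _×_; _,_; proj₁; proj₂)
open import Data.Product.Relation.Binary.Lex.Strict using (×-Lex; ×-isStrictTotalOrder)
open import Data.Product.Relation.Binary.Pointwise.NonDependent using (Pointwise; ≡⇒≡×≡)
open import Data.Sum using (_⊎_; inj₁; inj₂)
open import Data.Vec using (tabulate)
open import Data.Vec.Properties using (lookup∘tabulate; lookup⇒[]=; []=⇒lookup)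
open import Function using (_∘_)
open import Function.Bundles using (Equivalence; Injection)
open import Function.Definitions using (Injective)
open import Function.Properties.Inverse using (↔⇒↣)
open import Level using (0ℓ)
open import Relation.Binary.Core using (Rel)
open import Relation.Binary.Definitions using (Trichotomous; tri<; tri≈; tri>)
open import Relation.Binary.PropositionalEquality
open import Relation.Binary.Structures using (IsStrictTotalOrder)
open import Relation.Nullary using (¬_; does; yes; no; contradiction)
open import Relation.Nullary.Decidable using (dec-true; dec-false; decidable-stable)

n<ᵇn≡false : ∀ n → (n <ᵇ n) ≡ false
n<ᵇn≡false zero    = refl
n<ᵇn≡false (suc n) = n<ᵇn≡false n

module _ (f : ℕ → Bool) where

  IsLeastBelow : ℕ → ℕ → Set
  IsLeastBelow b r = (∀ {p} → p < r → f p ≡ false) × (r ≡ b ⊎ (r < b × f r ≡ true))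

  leastBelow-isLeast : ∀ b → IsLeastBelow b (leastBelow f b)
  leastBelow-isLeast zero = (λ ()) , inj₁ refl
  leastBelow-isLeast (suc b) with leastBelow f b | leastBelow-isLeast b
  ... | r | below , inj₂ (r<b , fr)
    rewrite Equivalence.to T-≡ (NP.<⇒<ᵇ r<b) = below , inj₂ (NP.m≤n⇒m≤1+n r<b , fr)
  ... | r | below , inj₁ refl
    rewrite n<ᵇn≡false r with f r in fr
  ... | true  = below , inj₂ (NP.n<1+n r , fr)
  ... | false = below′ , inj₁ refl
    where
    below′ : ∀ {p} → p < suc r → f p ≡ false
    below′ p<1+r with NP.m<1+n⇒m<n∨m≡n p<1+r
    ... | inj₁ p<r  = below p<r
    ... | inj₂ refl = fr

  leastBelow-witness : ∀ {b p} → p < b → f p ≡ true → f (leastBelow f b) ≡ true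
  leastBelow-witness {b} p<b fp with leastBelow-isLeast b
  ... | below , inj₁ r≡b      = contradiction (trans (sym fp) (below (subst (_ <_) (sym r≡b) p<b))) λ ()
  ... | _     , inj₂ (_ , fr) = fr

Fin-injective⇒surjective : ∀ {n} {f : Fin n → Fin n} → Injective _≡_ _≡_ f → ∀ y → ∃ λ x → f x ≡ y
Fin-injective⇒surjective {suc m} {f} f-injective y with FP.any? (λ x → f x FP.≟ y)
... | yes hit = hit
... | no miss = contradiction (FP.injective⇒≤ g-injective) (NP.n≮n m)
  where
  g : Fin (suc m) → Fin m
  g x = punchOut {i = y} {j = f x} (λ y≡fx → miss (x , sym y≡fx))
  g-injective : Injective _≡_ _≡_ g
  g-injective = f-injective ∘ FP.punchOut-injective {i = y} _ _

module _ {n ℓ} {_≺_ : Rel (Fin n) ℓ} (≺-isStrictTotalOrder : IsStrictTotalOrder _≡_ _≺_) where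
  open IsStrictTotalOrder ≺-isStrictTotalOrder using (_<?_; irrefl; compare) renaming (trans to ≺-trans)

  private
    below : Fin n → Subset n
    below k = tabulate (λ x → does (x <? k))

    ≺⇒∈below : ∀ {x k} → x ≺ k → x ∈ below k
    ≺⇒∈below {x} {k} x≺k = lookup⇒[]= x (below k) (trans (lookup∘tabulate _ x) (dec-true (x <? k) x≺k))

    ∈below⇒≺ : ∀ {x k} → x ∈ below k → x ≺ k
    ∈below⇒≺ {x} {k} x∈below = decidable-stable (x <? k) λ x⊀k → contradiction
      (trans (sym ([]=⇒lookup x∈below)) (trans (lookup∘tabulate _ x) (dec-false (x <? k) x⊀k))) λ ()

    rank : Fin n → ℕ
    rank k = ∣ below k ∣

    rank-mono : ∀ {a b} → a ≺ b → rank a < rank b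
    rank-mono {a} a≺b = p⊂q⇒∣p∣<∣q∣
      ( (≺⇒∈below ∘ λ x≺a → ≺-trans x≺a a≺b) ∘ ∈below⇒≺
      , a , ≺⇒∈below a≺b , irrefl refl ∘ ∈below⇒≺)

    rank<n : ∀ k → rank k < n
    rank<n k = subst (rank k <_) (∣⊤∣≡n n)
      (p⊂q⇒∣p∣<∣q∣ ((λ _ → ∈⊤) , k , ∈⊤ , irrefl refl ∘ ∈below⇒≺))

    rankFin : Fin n → Fin n
    rankFin k = fromℕ< (rank<n k)

    rankFin-mono : ∀ {a b} → a ≺ b → rankFin a F.< rankFin b
    rankFin-mono {a} {b} a≺b =
      subst₂ _<_ (sym (FP.toℕ-fromℕ< (rank<n a))) (sym (FP.toℕ-fromℕ< (rank<n b))) (rank-mono a≺b)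

    rankFin-injective : Injective _≡_ _≡_ rankFin
    rankFin-injective {a} {b} ra≡rb with compare a b
    ... | tri< a≺b _ _ = contradiction ra≡rb (FP.<⇒≢ (rankFin-mono a≺b))
    ... | tri≈ _ a≡b _ = a≡b
    ... | tri> _ _ b≺a = contradiction (sym ra≡rb) (FP.<⇒≢ (rankFin-mono b≺a))

    unrank : Fin n → Fin n
    unrank = proj₁ ∘ Fin-injective⇒surjective rankFin-injective

    rankFin-unrank : ∀ i → rankFin (unrank i) ≡ i
    rankFin-unrank = proj₂ ∘ Fin-injective⇒surjective rankFin-injective

    unrank-mono : ∀ i j → i F.< j → unrank i ≺ unrank j
    unrank-mono i j i<j with compare (unrank i) (unrank j)
    ... | tri< ui≺uj _ _ = ui≺uj
    ... | tri≈ _ ui≡uj _ = contradiction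
      (trans (sym (rankFin-unrank i)) (trans (cong rankFin ui≡uj) (rankFin-unrank j))) (FP.<⇒≢ i<j)
    ... | tri> _ _ uj≺ui = contradiction
      (subst₂ F._<_ (rankFin-unrank j) (rankFin-unrank i) (rankFin-mono uj≺ui)) (FP.<-asym i<j)

  increasingPermutation : Σ (Permutation′ n) λ π → ∀ i j → i F.< j → (π ⟨$⟩ʳ i) ≺ (π ⟨$⟩ʳ j)
  increasingPermutation =
      permutation unrank rankFin (λ k → rankFin-injective (rankFin-unrank (rankFin k))) rankFin-unrank
    , unrank-mono

<lex-isStrictTotalOrder : IsStrictTotalOrder (Pointwise _≡_ _≡_) (×-Lex _≡_ _<_ _<_)
<lex-isStrictTotalOrder = ×-isStrictTotalOrder NP.<-isStrictTotalOrder NP.<-isStrictTotalOrder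

<lex-zero⇒< : ∀ {a b c} → a , b <lex c , 0 → a < c
<lex-zero⇒< (inj₁ a<c) = a<c

<lex⇒≮lex-suc : ∀ {a j c d} → a , j <lex c , d → ¬ (c , d <lex a , suc j)
<lex⇒≮lex-suc (inj₁ a<c)        (inj₁ c<a)         = NP.<-asym a<c c<a
<lex⇒≮lex-suc (inj₁ a<a)        (inj₂ (refl , _))  = NP.<-irrefl refl a<a
<lex⇒≮lex-suc (inj₂ (refl , _)) (inj₁ a<a)         = NP.<-irrefl refl a<a
<lex⇒≮lex-suc (inj₂ (_ , j<d))  (inj₂ (_ , d<1+j)) = NP.<⇒≱ j<d (s≤s⁻¹ d<1+j)

module _ {n} (τ : Permutation′ n) where

  prevVal-suc : ∀ {p p′ : Fin n} → toℕ p ≡ suc (toℕ p′) → prevVal τ p ≡ val τ p′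
  prevVal-suc {suc r} r≡p′ =
    cong (val τ) (FP.toℕ-injective (trans (FP.toℕ-inject₁ r) (NP.suc-injective r≡p′)))

  prevVal-saillant : ∀ {p} → Saillant τ p → prevVal τ p ≤ toℕ (τ ⟨$⟩ʳ p)
  prevVal-saillant {zero}  _        = z≤n
  prevVal-saillant {suc r} saillant =
    saillant (inject₁ r) (subst (_< suc (toℕ r)) (sym (FP.toℕ-inject₁ r)) (NP.n<1+n _))

  private
    nextSaillant : Maybe (Fin n) → ℕ
    nextSaillant nothing  = 1
    nextSaillant (just q) = if does (saillant? τ q) then 1 else 0

    -- D′ with its where-bound helper replaced by one that can be reasoned about
    D′-unfold : ∀ j →
      D′ τ j ≡ (if does (saillant? τ (τ ⟨$⟩ˡ j)) then nextSaillant (nextPos (τ ⟨$⟩ˡ j)) else 0)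
    D′-unfold j with nextPos (τ ⟨$⟩ˡ j)
    ... | nothing = refl
    ... | just _  = refl

    nextSaillant≡1 : ∀ m → (∀ {q} → m ≡ just q → Saillant τ q) → nextSaillant m ≡ 1
    nextSaillant≡1 nothing  _             = refl
    nextSaillant≡1 (just q) next-saillant = if-cong (dec-true (saillant? τ q) (next-saillant refl))

  D′-¬saillant : ∀ {j} → ¬ Saillant τ (τ ⟨$⟩ˡ j) → D′ τ j ≡ 0
  D′-¬saillant {j} ¬s = trans (D′-unfold j) (if-cong (dec-false (saillant? τ _) ¬s))

  D′-next-¬saillant : ∀ {j q} → nextPos (τ ⟨$⟩ˡ j) ≡ just q → ¬ Saillant τ q → D′ τ j ≡ 0
  D′-next-¬saillant {j} {q} next≡q ¬s = begin
    D′ τ j                                               ≡⟨ D′-unfold j ⟩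
    (if b then nextSaillant (nextPos (τ ⟨$⟩ˡ j)) else 0) ≡⟨ if-cong-then b (cong nextSaillant next≡q) ⟩
    (if b then nextSaillant (just q) else 0)             ≡⟨ if-cong-then b (if-cong (dec-false (saillant? τ q) ¬s)) ⟩
    (if b then 0 else 0)                                 ≡⟨ if-eta b ⟩
    0                                                    ∎
    where
    open ≡-Reasoning
    b = does (saillant? τ (τ ⟨$⟩ˡ j))

  D′-saillant : ∀ {j} → Saillant τ (τ ⟨$⟩ˡ j) →
                (∀ {q} → nextPos (τ ⟨$⟩ˡ j) ≡ just q → Saillant τ q) → D′ τ j ≡ 1
  D′-saillant {j} s next-saillant =
    trans (D′-unfold j) (trans (if-cong (dec-true (saillant? τ _) s)) (nextSaillant≡1 _ next-saillant))

nextPos-just : ∀ {n} {p q : Fin n} → nextPos p ≡ just q → toℕ q ≡ suc (toℕ p)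
nextPos-just {suc (suc m)} {zero}  refl = refl
nextPos-just {suc (suc m)} {suc p} e with nextPos p in next≡
nextPos-just {suc (suc m)} {suc p} refl | just q = cong suc (nextPos-just next≡)

nextPos-suc : ∀ {n} {p q : Fin n} → toℕ q ≡ suc (toℕ p) → nextPos p ≡ just q
nextPos-suc {suc zero}    {zero}  {zero}     ()
nextPos-suc {suc (suc m)} {zero}  {suc zero} refl = refl
nextPos-suc {suc (suc m)} {suc p} {suc q}    e    = cong (Maybe.map suc) (nextPos-suc (NP.suc-injective e))

module Orbit {n} (σ : Permutation′ n) where

  σ^ : ℕ → Fin n → Fin n
  σ^ = iter σ

  σ^-+ : ∀ a b k → σ^ (a + b) k ≡ σ^ a (σ^ b k)
  σ^-+ zero    b k = refl
  σ^-+ (suc a) b k = cong (σ ⟨$⟩ʳ_) (σ^-+ a b k)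

  σ^-sucʳ : ∀ p k → σ^ p (σ ⟨$⟩ʳ k) ≡ σ^ (suc p) k
  σ^-sucʳ zero    k = refl
  σ^-sucʳ (suc p) k = cong (σ ⟨$⟩ʳ_) (σ^-sucʳ p k)

  σ-injective : Injective _≡_ _≡_ (σ ⟨$⟩ʳ_)
  σ-injective = Injection.injective (↔⇒↣ σ)

  σ^-injective : ∀ p {a b} → σ^ p a ≡ σ^ p b → a ≡ b
  σ^-injective zero    e = e
  σ^-injective (suc p) e = σ^-injective p (σ-injective e)

  -- pigeonhole on σ⁰ k, …, σⁿ k
  period : ∀ k → ∃ λ d → suc d ≤ n × σ^ (suc d) k ≡ k
  period k with FP.pigeonhole (NP.n<1+n n) (λ (i : Fin (suc n)) → σ^ (toℕ i) k)
  ... | i , j , i<j , σⁱk≡σʲk = d , 1+d≤n , σ^-injective (toℕ i) (begin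
      σ^ (toℕ i) (σ^ (suc d) k)  ≡⟨ σ^-+ (toℕ i) (suc d) k ⟨
      σ^ (toℕ i + suc d) k       ≡⟨ cong (λ e → σ^ e k) i+1+d≡j ⟩
      σ^ (toℕ j) k               ≡⟨ σⁱk≡σʲk ⟨
      σ^ (toℕ i) k               ∎)
    where
    open ≡-Reasoning
    d = toℕ j ∸ suc (toℕ i)
    1+d≡j∸i : suc d ≡ toℕ j ∸ toℕ i
    1+d≡j∸i = sym (NP.+-∸-assoc 1 i<j)
    i+1+d≡j : toℕ i + suc d ≡ toℕ j
    i+1+d≡j = trans (cong (toℕ i +_) 1+d≡j∸i) (NP.m+[n∸m]≡n (NP.<⇒≤ i<j))
    1+d≤n : suc d ≤ n
    1+d≤n = NP.≤-trans (subst (_≤ toℕ j) (sym 1+d≡j∸i) (NP.m∸n≤m (toℕ j) (toℕ i)))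
                       (NP.<⇒≤pred (FP.toℕ<n j))

  σ^-periodic : ∀ {d k} → σ^ d k ≡ k → ∀ q → σ^ (q * d) k ≡ k
  σ^-periodic         σᵈk≡k zero    = refl
  σ^-periodic {d} {k} σᵈk≡k (suc q) =
    trans (σ^-+ d (q * d) k) (trans (cong (σ^ d) (σ^-periodic σᵈk≡k q)) σᵈk≡k)

  σ^-reduce : ∀ j k → ∃ λ j′ → j′ < n × σ^ j k ≡ σ^ j′ k
  σ^-reduce j k with period k
  ... | d , 1+d≤n , σ^1+dk≡k = r , NP.<-≤-trans (m%n<n j (suc d)) 1+d≤n , (begin
      σ^ j k                 ≡⟨ cong (λ e → σ^ e k) (m≡m%n+[m/n]*n j (suc d)) ⟩
      σ^ (r + q * suc d) k   ≡⟨ σ^-+ r (q * suc d) k ⟩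
      σ^ r (σ^ (q * suc d) k) ≡⟨ cong (σ^ r) (σ^-periodic σ^1+dk≡k q) ⟩
      σ^ r k                 ∎)
    where
    open ≡-Reasoning
    r = j % suc d
    q = j / suc d

  σ^-σ : ∀ p k → ∃ λ p′ → σ^ p k ≡ σ^ p′ (σ ⟨$⟩ʳ k)
  σ^-σ p k with period k
  ... | d , _ , σ^1+dk≡k = p + d , (begin
      σ^ p k                 ≡⟨ cong (σ^ p) σ^1+dk≡k ⟨
      σ^ p (σ^ (suc d) k)    ≡⟨ σ^-+ p (suc d) k ⟨
      σ^ (p + suc d) k       ≡⟨ cong (λ e → σ^ e k) (NP.+-suc p d) ⟩
      σ^ (suc (p + d)) k     ≡⟨ σ^-sucʳ (p + d) k ⟨
      σ^ (p + d) (σ ⟨$⟩ʳ k)  ∎)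
    where open ≡-Reasoning

  toℕ-σ^≤maxUpTo : ∀ k {p r} → p ≤ r → toℕ (σ^ p k) ≤ maxUpTo σ k r
  toℕ-σ^≤maxUpTo k {r = zero}      z≤n   = NP.≤-refl
  toℕ-σ^≤maxUpTo k {p} {r = suc r} p≤1+r with NP.m≤n⇒m<n∨m≡n p≤1+r
  ... | inj₁ p<1+r = NP.≤-trans (toℕ-σ^≤maxUpTo k (s≤s⁻¹ p<1+r)) (NP.m≤m⊔n _ _)
  ... | inj₂ refl  = NP.m≤n⊔m (maxUpTo σ k r) _

  maxUpTo-attained : ∀ k r → ∃ λ p → p ≤ r × toℕ (σ^ p k) ≡ maxUpTo σ k r
  maxUpTo-attained k zero = 0 , z≤n , refl
  maxUpTo-attained k (suc r) with maxUpTo-attained k r | NP.≤-total (maxUpTo σ k r) (toℕ (σ^ (suc r) k))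
  ... | _ , _   , _ | inj₁ ≤new = suc r , NP.≤-refl , sym (NP.m≤n⇒m⊔n≡n ≤new)
  ... | p , p≤r , e | inj₂ ≥new = p , NP.m≤n⇒m≤1+n p≤r , trans e (sym (NP.m≥n⇒m⊔n≡m ≥new))

  toℕ-σ^≤orbitMax : ∀ j k → toℕ (σ^ j k) ≤ orbitMax σ k
  toℕ-σ^≤orbitMax j k with σ^-reduce j k
  ... | j′ , j′<n , σʲk≡σʲ′k =
    subst (λ x → toℕ x ≤ orbitMax σ k) (sym σʲk≡σʲ′k) (toℕ-σ^≤maxUpTo k (NP.<⇒≤pred j′<n))

  orbitMax-attained : ∀ k → ∃ λ p → p < n × toℕ (σ^ p k) ≡ orbitMax σ k
  orbitMax-attained k with maxUpTo-attained k (n ∸ 1)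
  ... | p , p≤n∸1 , e = p , NP.m≤pred[n]⇒suc[m]≤n {{FP.nonZeroIndex k}} p≤n∸1 , e

  orbitMax-σ : ∀ k → orbitMax σ (σ ⟨$⟩ʳ k) ≡ orbitMax σ k
  orbitMax-σ k with orbitMax-attained (σ ⟨$⟩ʳ k) | orbitMax-attained k
  ... | p , _ , σᵖσk≡max | q , _ , σ^qk≡max with σ^-σ q k
  ... | q′ , σ^qk≡σ^q′σk = NP.≤-antisym
    (begin
      orbitMax σ (σ ⟨$⟩ʳ k)   ≡⟨ σᵖσk≡max ⟨
      toℕ (σ^ p (σ ⟨$⟩ʳ k))   ≡⟨ cong toℕ (σ^-sucʳ p k) ⟩
      toℕ (σ^ (suc p) k)      ≤⟨ toℕ-σ^≤orbitMax (suc p) k ⟩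
      orbitMax σ k            ∎)
    (begin
      orbitMax σ k            ≡⟨ σ^qk≡max ⟨
      toℕ (σ^ q k)            ≡⟨ cong toℕ σ^qk≡σ^q′σk ⟩
      toℕ (σ^ q′ (σ ⟨$⟩ʳ k))  ≤⟨ toℕ-σ^≤orbitMax q′ (σ ⟨$⟩ʳ k) ⟩
      orbitMax σ (σ ⟨$⟩ʳ k)   ∎)
    where open NP.≤-Reasoning

  orbitMax-σ^ : ∀ p k → orbitMax σ (σ^ p k) ≡ orbitMax σ k
  orbitMax-σ^ zero    k = refl
  orbitMax-σ^ (suc p) k = trans (orbitMax-σ (σ^ p k)) (orbitMax-σ^ p k)

  reachesMax : Fin n → ℕ → Bool
  reachesMax k p = toℕ (σ^ p k) ≡ᵇ orbitMax σ k

  orbitTop : Fin n → Fin n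
  orbitTop k = σ^ (qIndex σ k) k

  toℕ-orbitTop : ∀ k → toℕ (orbitTop k) ≡ orbitMax σ k
  toℕ-orbitTop k with orbitMax-attained k
  ... | p , p<n , σᵖk≡max = NP.≡ᵇ⇒≡ _ _ (Equivalence.from T-≡
    (leastBelow-witness (reachesMax k) p<n (Equivalence.to T-≡ (NP.≡⇒≡ᵇ _ _ σᵖk≡max))))

  qIndex-minimal : ∀ k {p} → p < qIndex σ k → toℕ (σ^ p k) ≢ orbitMax σ k
  qIndex-minimal k p<q σᵖk≡max =
    subst T (proj₁ (leastBelow-isLeast (reachesMax k) n) p<q) (NP.≡⇒≡ᵇ _ _ σᵖk≡max)

  qIndex-unique : ∀ k {p} → toℕ (σ^ p k) ≡ orbitMax σ k →
                  (∀ {p′} → p′ < p → toℕ (σ^ p′ k) ≢ orbitMax σ k) → qIndex σ k ≡ p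
  qIndex-unique k {p} σᵖk≡max minimal with NP.<-cmp (qIndex σ k) p
  ... | tri< q<p _ _ = contradiction (toℕ-orbitTop k) (minimal q<p)
  ... | tri≈ _ q≡p _ = q≡p
  ... | tri> _ _ p<q = contradiction σᵖk≡max (qIndex-minimal k p<q)

  qIndex≡0⇒toℕ≡orbitMax : ∀ {k} → qIndex σ k ≡ 0 → toℕ k ≡ orbitMax σ k
  qIndex≡0⇒toℕ≡orbitMax {k} q≡0 = subst (λ q → toℕ (σ^ q k) ≡ orbitMax σ k) q≡0 (toℕ-orbitTop k)

  toℕ≡orbitMax⇒qIndex≡0 : ∀ {k} → toℕ k ≡ orbitMax σ k → qIndex σ k ≡ 0
  toℕ≡orbitMax⇒qIndex≡0 {k} k≡max = qIndex-unique k k≡max λ ()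

  qIndex-σ : ∀ {k j} → qIndex σ k ≡ suc j → qIndex σ (σ ⟨$⟩ʳ k) ≡ j
  qIndex-σ {k} {j} q≡1+j = qIndex-unique (σ ⟨$⟩ʳ k) σʲσk≡max minimal
    where
    open ≡-Reasoning
    σʲσk≡max : toℕ (σ^ j (σ ⟨$⟩ʳ k)) ≡ orbitMax σ (σ ⟨$⟩ʳ k)
    σʲσk≡max = begin
      toℕ (σ^ j (σ ⟨$⟩ʳ k))  ≡⟨ cong toℕ (σ^-sucʳ j k) ⟩
      toℕ (σ^ (suc j) k)     ≡⟨ cong (λ q → toℕ (σ^ q k)) q≡1+j ⟨
      toℕ (orbitTop k)       ≡⟨ toℕ-orbitTop k ⟩
      orbitMax σ k           ≡⟨ orbitMax-σ k ⟨
      orbitMax σ (σ ⟨$⟩ʳ k)  ∎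
    minimal : ∀ {p} → p < j → toℕ (σ^ p (σ ⟨$⟩ʳ k)) ≢ orbitMax σ (σ ⟨$⟩ʳ k)
    minimal {p} p<j σᵖσk≡max = qIndex-minimal k (subst (suc p <_) (sym q≡1+j) (s<s p<j))
      (trans (cong toℕ (sym (σ^-sucʳ p k))) (trans σᵖσk≡max (orbitMax-σ k)))

  orbitMax-orbitTop : ∀ k → orbitMax σ (orbitTop k) ≡ orbitMax σ k
  orbitMax-orbitTop k = orbitMax-σ^ (qIndex σ k) k

  qIndex-orbitTop : ∀ k → qIndex σ (orbitTop k) ≡ 0
  qIndex-orbitTop k = toℕ≡orbitMax⇒qIndex≡0 (trans (toℕ-orbitTop k) (sym (orbitMax-orbitTop k)))

  key-injective : ∀ {a b} → orbitMax σ a ≡ orbitMax σ b → qIndex σ a ≡ qIndex σ b → a ≡ b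
  key-injective {a} {b} ā≡b̄ qa≡qb = σ^-injective (qIndex σ a) (FP.toℕ-injective (begin
    toℕ (orbitTop a)         ≡⟨ toℕ-orbitTop a ⟩
    orbitMax σ a             ≡⟨ ā≡b̄ ⟩
    orbitMax σ b             ≡⟨ toℕ-orbitTop b ⟨
    toℕ (orbitTop b)         ≡⟨ cong (λ q → toℕ (σ^ q b)) qa≡qb ⟨
    toℕ (σ^ (qIndex σ a) b)  ∎))
    where open ≡-Reasoning

  toℕ≡orbitMax⇒σ≤ : ∀ {k} → toℕ k ≡ orbitMax σ k → toℕ (σ ⟨$⟩ʳ k) ≤ toℕ k
  toℕ≡orbitMax⇒σ≤ {k} k≡max = subst (toℕ (σ ⟨$⟩ʳ k) ≤_) (sym k≡max) (toℕ-σ^≤orbitMax 1 k)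

  E-fixed : ∀ {k} → σ ⟨$⟩ʳ k ≡ k → E σ k ≡ 1
  E-fixed {k} σk≡k = trans (cong (λ x → suc (toℕ x) ∸ toℕ k) σk≡k) (NP.m+n∸n≡m 1 (toℕ k))

  E-orbitMax-moved : ∀ {k} → toℕ k ≡ orbitMax σ k → σ ⟨$⟩ʳ k ≢ k → E σ k ≡ 0
  E-orbitMax-moved k≡max σk≢k =
    NP.m≤n⇒m∸n≡0 (NP.≤∧≢⇒< (toℕ≡orbitMax⇒σ≤ k≡max) (σk≢k ∘ FP.toℕ-injective))

  E-orbitMax≤1 : ∀ {k} → toℕ k ≡ orbitMax σ k → E σ k ≤ 1
  E-orbitMax≤1 {k} k≡max =
    subst (E σ k ≤_) (NP.m+n∸n≡m 1 (toℕ k))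
      (NP.∸-monoˡ-≤ (toℕ k) (s≤s (toℕ≡orbitMax⇒σ≤ k≡max)))

module KeyOrder {n} (σ : Permutation′ n) where
  open Orbit σ

  -- Definitionally ×-Lex _≡_ _<_ _<_ on (orbitMax σ k , qIndex σ k); IsHat σ τ says
  -- exactly that τ is ⊏-increasing.
  _⊏_ : Rel (Fin n) 0ℓ
  a ⊏ b = orbitMax σ a , qIndex σ a <lex orbitMax σ b , qIndex σ b

  ⊏-isStrictTotalOrder : IsStrictTotalOrder _≡_ _⊏_
  ⊏-isStrictTotalOrder = record
    { isStrictPartialOrder = record
      { isEquivalence = isEquivalence
      ; irrefl        = λ { refl → Lex.irrefl (refl , refl) }
      ; trans         = Lex.trans
      ; <-resp-≈      = resp₂ _⊏_
      }
    ; compare = compare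
    }
    where
    module Lex = IsStrictTotalOrder <lex-isStrictTotalOrder
    key : Fin n → ℕ × ℕ
    key k = orbitMax σ k , qIndex σ k
    compare : Trichotomous _≡_ _⊏_
    compare a b with Lex.compare (key a) (key b)
    ... | tri< a⊏b ≉ b⊐a              = tri< a⊏b (≉ ∘ ≡⇒≡×≡ ∘ cong key) b⊐a
    ... | tri≈ a⊐b (ā≡b̄ , qa≡qb) b⊏a = tri≈ a⊐b (key-injective ā≡b̄ qa≡qb) b⊏a
    ... | tri> a⊐b ≉ b⊏a              = tri> a⊐b (≉ ∘ ≡⇒≡×≡ ∘ cong key) b⊏a

module Hat {n} (σ τ : Permutation′ n) (hat : IsHat σ τ) where
  open Orbit σ
  open KeyOrder σ
  open IsStrictTotalOrder ⊏-isStrictTotalOrder using (irrefl; asym)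

  pos : Fin n → Fin n
  pos = τ ⟨$⟩ˡ_

  pos-injective : Injective _≡_ _≡_ pos
  pos-injective = Injection.injective (↔⇒↣ (flip τ))

  ⊏-τ : ∀ {a r} → pos a F.< r → a ⊏ (τ ⟨$⟩ʳ r)
  ⊏-τ {a} {r} a<r = subst (_⊏ (τ ⟨$⟩ʳ r)) (inverseʳ τ) (hat (pos a) r a<r)

  τ-⊏ : ∀ {r b} → r F.< pos b → (τ ⟨$⟩ʳ r) ⊏ b
  τ-⊏ {r} {b} r<b = subst ((τ ⟨$⟩ʳ r) ⊏_) (inverseʳ τ) (hat r (pos b) r<b)

  ⊏⇒pos< : ∀ {a b} → a ⊏ b → pos a F.< pos b
  ⊏⇒pos< {a} {b} a⊏b with FP.<-cmp (pos a) (pos b)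
  ... | tri< a<b _ _ = a<b
  ... | tri≈ _ a≡b _ = contradiction a⊏b (irrefl (pos-injective a≡b))
  ... | tri> _ _ b<a = contradiction (subst (b ⊏_) (inverseʳ τ) (⊏-τ b<a)) (asym a⊏b)

  pos-adjacent : ∀ {a b} → a ⊏ b → (∀ c → a ⊏ c → ¬ c ⊏ b) → toℕ (pos b) ≡ suc (toℕ (pos a))
  pos-adjacent {a} {b} a⊏b nothing-between with NP.m≤n⇒m<n∨m≡n (⊏⇒pos< a⊏b)
  ... | inj₂ 1+a≡b = sym 1+a≡b
  ... | inj₁ 1+a<b = contradiction (τ-⊏ r<b) (nothing-between (τ ⟨$⟩ʳ r) (⊏-τ a<r))
    where
    r : Fin n
    r = fromℕ< (NP.<-trans 1+a<b (FP.toℕ<n (pos b)))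
    toℕ-r : toℕ r ≡ suc (toℕ (pos a))
    toℕ-r = FP.toℕ-fromℕ< _
    a<r : pos a F.< r
    a<r = subst (toℕ (pos a) <_) (sym toℕ-r) (NP.n<1+n _)
    r<b : r F.< pos b
    r<b = subst (_< toℕ (pos b)) (sym toℕ-r) 1+a<b

  -- the keys (k̄, j) of σ x and (k̄, j + 1) of x are consecutive
  pos-σ : ∀ {x j} → qIndex σ x ≡ suc j → toℕ (pos x) ≡ suc (toℕ (pos (σ ⟨$⟩ʳ x)))
  pos-σ {x} {j} qx≡1+j = pos-adjacent σx⊏x λ c σx⊏c c⊏x → <lex⇒≮lex-suc
      (subst₂ (λ u v → u , v <lex orbitMax σ c , qIndex σ c) (orbitMax-σ x) (qIndex-σ qx≡1+j) σx⊏c)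
      (subst (λ v → orbitMax σ c , qIndex σ c <lex orbitMax σ x , v) qx≡1+j c⊏x)
    where
    σx⊏x : (σ ⟨$⟩ʳ x) ⊏ x
    σx⊏x = inj₂ (orbitMax-σ x , subst₂ _<_ (sym (qIndex-σ qx≡1+j)) (sym qx≡1+j) (NP.n<1+n j))

  saillant-pos : ∀ {x} → qIndex σ x ≡ 0 → Saillant τ (pos x)
  saillant-pos {x} qx≡0 i i<x = begin-strict
    toℕ (τ ⟨$⟩ʳ i)         ≤⟨ toℕ-σ^≤orbitMax 0 (τ ⟨$⟩ʳ i) ⟩
    orbitMax σ (τ ⟨$⟩ʳ i)  <⟨ <lex-zero⇒< (subst (λ v → _ , _ <lex orbitMax σ x , v) qx≡0 (τ-⊏ i<x)) ⟩
    orbitMax σ x           ≡⟨ qIndex≡0⇒toℕ≡orbitMax qx≡0 ⟨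
    toℕ x                  ≡⟨ cong toℕ (inverseʳ τ) ⟨
    toℕ (τ ⟨$⟩ʳ pos x)     ∎
    where open NP.≤-Reasoning

  ¬saillant-pos : ∀ {x j} → qIndex σ x ≡ suc j → ¬ Saillant τ (pos x)
  ¬saillant-pos {x} qx≡1+j saillant = NP.<⇒≱ top<x x≤top
    where
    top⊏x : orbitTop x ⊏ x
    top⊏x = inj₂ (orbitMax-orbitTop x , subst₂ _<_ (sym (qIndex-orbitTop x)) (sym qx≡1+j) z<s)
    top<x : toℕ (orbitTop x) < toℕ x
    top<x = subst₂ (λ u v → toℕ u < toℕ v) (inverseʳ τ) (inverseʳ τ) (saillant _ (⊏⇒pos< top⊏x))
    x≤top : toℕ x ≤ toℕ (orbitTop x)
    x≤top = subst (toℕ x ≤_) (sym (toℕ-orbitTop x)) (toℕ-σ^≤orbitMax 0 x)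

  D≡E-nonmax : ∀ {k j} → qIndex σ k ≡ suc j → D τ k ≡ E σ k
  D≡E-nonmax {k} qk≡1+j =
    cong (_∸ toℕ k) (trans (prevVal-suc τ (pos-σ qk≡1+j)) (cong (suc ∘ toℕ) (inverseʳ τ)))

  D′≡0-nonmax : ∀ {k j} → qIndex σ k ≡ suc j → D′ τ k ≡ 0
  D′≡0-nonmax qk≡1+j = D′-¬saillant τ (¬saillant-pos qk≡1+j)

  D≡0-max : ∀ {k} → qIndex σ k ≡ 0 → D τ k ≡ 0
  D≡0-max {k} qk≡0 = NP.m≤n⇒m∸n≡0
    (subst (λ y → prevVal τ (pos k) ≤ toℕ y) (inverseʳ τ) (prevVal-saillant τ (saillant-pos qk≡0)))

  -- A non-saillant successor x of k would be immediately preceded by σ x, so σ x = k = σ k.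
  D′≡1-fixed : ∀ {k} → qIndex σ k ≡ 0 → σ ⟨$⟩ʳ k ≡ k → D′ τ k ≡ 1
  D′≡1-fixed {k} qk≡0 σk≡k = D′-saillant τ (saillant-pos qk≡0) next-saillant
    where
    next-saillant : ∀ {r} → nextPos (pos k) ≡ just r → Saillant τ r
    next-saillant {r} next≡r with qIndex σ (τ ⟨$⟩ʳ r) in qx≡
    ... | zero  = subst (Saillant τ) (inverseˡ τ) (saillant-pos qx≡)
    ... | suc _ = contradiction (trans (cong toℕ (sym r≡pos-k)) (nextPos-just next≡r)) (NP.1+n≢n ∘ sym)
      where
      x = τ ⟨$⟩ʳ r
      σx≡k : σ ⟨$⟩ʳ x ≡ k
      σx≡k = pos-injective (FP.toℕ-injective (NP.suc-injective
        (trans (sym (pos-σ qx≡)) (trans (cong toℕ (inverseˡ τ)) (nextPos-just next≡r)))))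
      r≡pos-k : r ≡ pos k
      r≡pos-k = trans (sym (inverseˡ τ)) (cong pos (σ-injective (trans σx≡k (sym σk≡k))))

  -- σ⁻¹ k lies in the cycle of k without being its maximum, so it is the non-saillant successor of k.
  D′≡0-moved : ∀ {k} → qIndex σ k ≡ 0 → σ ⟨$⟩ʳ k ≢ k → D′ τ k ≡ 0
  D′≡0-moved {k} qk≡0 σk≢k with qIndex σ (σ ⟨$⟩ˡ k) in qx≡
  ... | zero  = contradiction (trans (cong (σ ⟨$⟩ʳ_) (sym x≡k)) (inverseʳ σ)) σk≢k
    where
    x≡k : σ ⟨$⟩ˡ k ≡ k
    x≡k = FP.toℕ-injective (begin
      toℕ (σ ⟨$⟩ˡ k)                  ≡⟨ qIndex≡0⇒toℕ≡orbitMax qx≡ ⟩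
      orbitMax σ (σ ⟨$⟩ˡ k)           ≡⟨ orbitMax-σ _ ⟨
      orbitMax σ (σ ⟨$⟩ʳ (σ ⟨$⟩ˡ k))  ≡⟨ cong (orbitMax σ) (inverseʳ σ) ⟩
      orbitMax σ k                    ≡⟨ qIndex≡0⇒toℕ≡orbitMax qk≡0 ⟨
      toℕ k                           ∎)
      where open ≡-Reasoning
  ... | suc _ = D′-next-¬saillant τ (nextPos-suc x-after-k) (¬saillant-pos qx≡)
    where
    x-after-k : toℕ (pos (σ ⟨$⟩ˡ k)) ≡ suc (toℕ (pos k))
    x-after-k = subst (λ y → toℕ (pos (σ ⟨$⟩ˡ k)) ≡ suc (toℕ (pos y))) (inverseʳ σ) (pos-σ qx≡)

  E≡D′-max : ∀ {k} → qIndex σ k ≡ 0 → E σ k ≡ D′ τ k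
  E≡D′-max {k} qk≡0 with σ ⟨$⟩ʳ k FP.≟ k
  ... | yes σk≡k = trans (E-fixed σk≡k) (sym (D′≡1-fixed qk≡0 σk≡k))
  ... | no  σk≢k =
    trans (E-orbitMax-moved (qIndex≡0⇒toℕ≡orbitMax qk≡0) σk≢k) (sym (D′≡0-moved qk≡0 σk≢k))

  E≡D+D′ : ∀ k → E σ k ≡ D τ k + D′ τ k
  E≡D+D′ k with qIndex σ k in qk≡
  ... | suc _ = sym (trans (cong₂ _+_ (D≡E-nonmax qk≡) (D′≡0-nonmax qk≡)) (NP.+-identityʳ (E σ k)))
  ... | zero  = trans (E≡D′-max qk≡) (sym (cong (_+ D′ τ k) (D≡0-max qk≡)))

  E∸1≡D∸1 : ∀ k → E σ k ∸ 1 ≡ D τ k ∸ 1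
  E∸1≡D∸1 k with qIndex σ k in qk≡
  ... | suc _ = cong (_∸ 1) (sym (D≡E-nonmax qk≡))
  ... | zero  = trans (NP.m≤n⇒m∸n≡0 (E-orbitMax≤1 (qIndex≡0⇒toℕ≡orbitMax qk≡)))
                      (sym (cong (_∸ 1) (D≡0-max qk≡)))

mainTheorem3 : (m : ℕ) (σ : Permutation′ (suc m)) →
    Σ (Permutation′ (suc m)) (IsHat σ) ×
    ((τ : Permutation′ (suc m)) → IsHat σ τ →
      ((k : Fin (suc m)) → E σ k ≡ D τ k + D′ τ k) ×
      ((i : Fin m) → Δ (E σ) i ≡ Δ (D τ) i))
mainTheorem3 m σ =
    increasingPermutation (KeyOrder.⊏-isStrictTotalOrder σ)
  , λ τ hat → Hat.E≡D+D′ σ τ hat , λ i → Hat.E∸1≡D∸1 σ τ hat (inject₁ i)
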